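{- For every $n\ge 0$, the map $\phi'$ is a bijection from the set of Motzkin paths of length $2n$ to the set of paths in $\mathcal{A}^{Q}_{R}$ of horizontal length $n$, and also from the set of Grand Motzkin paths of length $2n$ to the set of paths in $\mathcal{A}^{H}_{R}$ of horizontal length $n$; its inverse is $\psi'$.
   Context: A lattice path is a finite sequence of steps (vectors in $\mathbb{Z}^2$) starting at $(0,0)$; its vertices are the partial sums. Let $S_{M}=\{(1,0),(1,1),(1,-1)\}$ and $S_{MW}=S_M\cup\{(0,1),(0,-1)\}$; $(0,\pm1)$ are vertical steps. A Grand Motzkin path of length $L$ is a lattice path of $L$ steps from $S_M$ (any endpoint); a Motzkin path of length $L$ is a Grand Motzkin path of length $L$ all of whose vertices have $y\ge0$. A vertically constrained $S_{MW}$ path is a lattice path with steps in $S_{MW}$ with no two consecutive vertical steps; its horizontal length is the $x$-coordinate of its endpoint. $\mathcal{A}^{H}_{R}$ is the set of vertically constrained $S_{MW}$ paths whose first step (if any) lies in $S_M$, and $\mathcal{A}^{Q}_{R}$ the subset of those all of whose vertices have $y\ge0$. The map $\phi'$ acts on a path with steps $e_1,\dots,e_{2n}$ by modifying each step $e_i$ with $i$ even: $(1,1)\mapsto(0,1)$, $(1,-1)\mapsto(0,-1)$, $(1,0)$ deleted; odd-indexed steps are kept. The map $\psi'$ acts on a path in $\mathcal{A}^H_R$ of horizontal length $n$: for each $i\in\{1,\dots,n\}$, if there is a vertical step at $x$-coordinate $i$ (there is at most one), replace $(0,1)$ by $(1,1)$ and $(0,-1)$ by $(1,-1)$; otherwise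 insert a step $(1,0)$ at the vertex with $x$-coordinate $i$ (subsequent steps shifted accordingly). -}

module Defs where

open import Data.Nat using (ℕ; zero; suc; _+_)
open import Data.Integer as ℤ using (ℤ; 0ℤ; 1ℤ; -1ℤ)
open import Data.List using (List; []; _∷_; map)
open import Data.Product using (_×_)
open import Data.Unit using (⊤)
open import Data.Empty using (⊥)

data MStep : Set where
  h u d : MStep

data WStep : Set where
  H U D N S : WStep

-- A lattice path is the list of its steps (starting at (0,0)).
-- A Grand Motzkin path of length L is any  p : List MStep  with  length p ≡ L.

emb : MStep → WStep
emb h = H
emb u = U
emb d = D

dx : WStep → ℕ
dx N = 0
dx S = 0
dx _ = 1

dy : WStep → ℤ
dy H = 0ℤ
dy U = 1ℤ
dy D = -1ℤ
dy N = 1ℤ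
dy S = -1ℤ

IsVertical : WStep → Set
IsVertical N = ⊤
IsVertical S = ⊤
IsVertical _ = ⊥

NonNegFrom : ℤ → List WStep → Set
NonNegFrom y [] = ⊤
NonNegFrom y (s ∷ r) = (0ℤ ℤ.≤ y ℤ.+ dy s) × NonNegFrom (y ℤ.+ dy s) r

NonNeg : List WStep → Set
NonNeg p = NonNegFrom 0ℤ p

IsMotzkin : List MStep → Set
IsMotzkin p = NonNeg (map emb p)

hlen : List WStep → ℕ
hlen [] = 0
hlen (s ∷ r) = dx s + hlen r

NoTwoVertical : List WStep → Set
NoTwoVertical [] = ⊤
NoTwoVertical (s ∷ []) = ⊤
NoTwoVertical (s ∷ t ∷ r) = (IsVertical s → IsVertical t → ⊥) × NoTwoVertical (t ∷ r)

FirstNonVertical : List WStep → Set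
FirstNonVertical [] = ⊤
FirstNonVertical (s ∷ r) = IsVertical s → ⊥

InAH : List WStep → Set
InAH p = NoTwoVertical p × FirstNonVertical p

InAQ : List WStep → Set
InAQ p = InAH p × NonNeg p

vert : MStep → List WStep
vert h = []
vert u = N ∷ []
vert d = S ∷ []

-- φ' : odd-indexed steps kept, even-indexed steps modified
-- (on odd-length input the final odd-indexed step is simply kept)
φ′ : List MStep → List WStep
φ′ [] = []
φ′ (a ∷ []) = emb a ∷ []
φ′ (a ∷ b ∷ r) = emb a ∷ (vert b Data.List.++ φ′ r)

-- ψ' : after each non-vertical step (reaching x = i), if the next step is
-- vertical it is turned into the corresponding diagonal step, otherwise a
-- (1,0) step is inserted at that vertex.
-- (Vertical steps not directly preceded by a non-vertical step do not occur
-- in A^H_R; on such junk input they are dropped.)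
mutual
  ψ′ : List WStep → List MStep
  ψ′ [] = []
  ψ′ (H ∷ r) = h ∷ ψ′-after r
  ψ′ (U ∷ r) = u ∷ ψ′-after r
  ψ′ (D ∷ r) = d ∷ ψ′-after r
  ψ′ (N ∷ r) = ψ′ r
  ψ′ (S ∷ r) = ψ′ r

  ψ′-after : List WStep → List MStep
  ψ′-after (N ∷ r) = u ∷ ψ′ r
  ψ′-after (S ∷ r) = d ∷ ψ′ r
  ψ′-after r = h ∷ ψ′ r

-- An even-length path splits into blocks (odd step, even step), and φ′ turns a block into
-- one step of horizontal extent 1 followed by at most one vertical step. So the image has
-- horizontal length n, starts with a non-vertical step and never has two vertical steps in
-- a row; conversely such a path cuts uniquely into these blocks, which ψ′ undoes. A block's
-- vertical displacement is unchanged and a deleted (1,0) step is flat, so the heights of the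
-- surviving vertices are the same and nonnegativity transfers in both directions.
module Submission where

open import Defs
open import Data.Nat using (ℕ; suc; _*_)
open import Data.Nat.Properties using (*-suc; *-cancelˡ-≡; suc-injective)
open import Data.Integer using (0ℤ; _≤_)
open import Data.Integer.Properties using (+-identityʳ)
open import Data.List using (List; []; _∷_; length; map; _++_)
open import Data.Product using (Σ; _×_; _,_)
open import Data.Empty using (⊥-elim)
open import Data.Unit using (tt)
open import Relation.Nullary using (¬_)
open import Relation.Binary.PropositionalEquality
  using (_≡_; refl; sym; trans; cong; subst; module ≡-Reasoning)

data EvenLength {A : Set} : List A → Set where
  []    : EvenLength []
  block : ∀ a b {r} → EvenLength r → EvenLength (a ∷ b ∷ r)

evenLength : ∀ {A : Set} n (p : List A) → length p ≡ 2 * n → EvenLength p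
evenLength 0       []          _ = []
evenLength (suc n) (a ∷ b ∷ r) e =
  block a b (evenLength n r (suc-injective (suc-injective (trans e (*-suc 2 n)))))
evenLength (suc n) (a ∷ [])    e with trans e (*-suc 2 n)
... | ()

hlen-vert-++ : ∀ b q → hlen (vert b ++ q) ≡ hlen q
hlen-vert-++ h q = refl
hlen-vert-++ u q = refl
hlen-vert-++ d q = refl

hlen-φ′-block : ∀ a b r → hlen (φ′ (a ∷ b ∷ r)) ≡ suc (hlen (φ′ r))
hlen-φ′-block h b r = cong suc (hlen-vert-++ b (φ′ r))
hlen-φ′-block u b r = cong suc (hlen-vert-++ b (φ′ r))
hlen-φ′-block d b r = cong suc (hlen-vert-++ b (φ′ r))

length≡2*hlen-φ′ : ∀ {p} → EvenLength p → length p ≡ 2 * hlen (φ′ p)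
length≡2*hlen-φ′ []                = refl
length≡2*hlen-φ′ (block a b {r} e) = begin
  suc (suc (length r))        ≡⟨ cong (λ k → suc (suc k)) (length≡2*hlen-φ′ e) ⟩
  suc (suc (2 * hlen (φ′ r))) ≡⟨ sym (*-suc 2 (hlen (φ′ r))) ⟩
  2 * suc (hlen (φ′ r))       ≡⟨ cong (2 *_) (sym (hlen-φ′-block a b r)) ⟩
  2 * hlen (φ′ (a ∷ b ∷ r))   ∎
  where open ≡-Reasoning

hlen-φ′ : ∀ n p → length p ≡ 2 * n → hlen (φ′ p) ≡ n
hlen-φ′ n p e =
  *-cancelˡ-≡ (hlen (φ′ p)) n 2 (trans (sym (length≡2*hlen-φ′ (evenLength n p e))) e)

emb-nonVertical : ∀ a → ¬ IsVertical (emb a)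
emb-nonVertical h ()
emb-nonVertical u ()
emb-nonVertical d ()

NoTwoVertical-∷ : ∀ s r → (IsVertical s → FirstNonVertical r) → NoTwoVertical r →
                  NoTwoVertical (s ∷ r)
NoTwoVertical-∷ s []      _     _   = tt
NoTwoVertical-∷ s (t ∷ r) first ntv = first , ntv

NoTwoVertical-vert-++ : ∀ b q → InAH q → NoTwoVertical (vert b ++ q)
NoTwoVertical-vert-++ h q (ntv , _)     = ntv
NoTwoVertical-vert-++ u q (ntv , first) = NoTwoVertical-∷ N q (λ _ → first) ntv
NoTwoVertical-vert-++ d q (ntv , first) = NoTwoVertical-∷ S q (λ _ → first) ntv

InAH-φ′ : ∀ p → InAH (φ′ p)
InAH-φ′ []          = tt , tt
InAH-φ′ (a ∷ [])    = tt , emb-nonVertical a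
InAH-φ′ (a ∷ b ∷ r) =
  NoTwoVertical-∷ (emb a) (vert b ++ φ′ r) (λ v → ⊥-elim (emb-nonVertical a v))
                  (NoTwoVertical-vert-++ b (φ′ r) (InAH-φ′ r))
  , emb-nonVertical a

ψ′-emb : ∀ a q → ψ′ (emb a ∷ q) ≡ a ∷ ψ′-after q
ψ′-emb h q = refl
ψ′-emb u q = refl
ψ′-emb d q = refl

ψ′-after-φ′ : ∀ {r} → EvenLength r → ψ′-after (φ′ r) ≡ h ∷ ψ′ (φ′ r)
ψ′-after-φ′ []            = refl
ψ′-after-φ′ (block h _ _) = refl
ψ′-after-φ′ (block u _ _) = refl
ψ′-after-φ′ (block d _ _) = refl

ψ′-after-vert-++ : ∀ b {r} → EvenLength r → ψ′-after (vert b ++ φ′ r) ≡ b ∷ ψ′ (φ′ r)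
ψ′-after-vert-++ h e = ψ′-after-φ′ e
ψ′-after-vert-++ u e = refl
ψ′-after-vert-++ d e = refl

ψ′∘φ′ : ∀ {p} → EvenLength p → ψ′ (φ′ p) ≡ p
ψ′∘φ′ []                = refl
ψ′∘φ′ (block a b {r} e) = begin
  ψ′ (emb a ∷ (vert b ++ φ′ r)) ≡⟨ ψ′-emb a (vert b ++ φ′ r) ⟩
  a ∷ ψ′-after (vert b ++ φ′ r) ≡⟨ cong (a ∷_) (ψ′-after-vert-++ b e) ⟩
  a ∷ b ∷ ψ′ (φ′ r)             ≡⟨ cong (λ q → a ∷ b ∷ q) (ψ′∘φ′ e) ⟩
  a ∷ b ∷ r                     ∎
  where open ≡-Reasoning

NonNegFrom-φ′ : ∀ {p} → EvenLength p → ∀ y → NonNegFrom y (map emb p) → NonNegFrom y (φ′ p)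
NonNegFrom-φ′ []                y _ = tt
NonNegFrom-φ′ (block a h {r} e) y (first , _ , rest) =
  first , subst (λ z → NonNegFrom z (φ′ r)) (+-identityʳ _) (NonNegFrom-φ′ e _ rest)
NonNegFrom-φ′ (block a u e) y (first , second , rest) = first , second , NonNegFrom-φ′ e _ rest
NonNegFrom-φ′ (block a d e) y (first , second , rest) = first , second , NonNegFrom-φ′ e _ rest

NonNegFrom-φ′⁻¹ : ∀ {p} → EvenLength p → ∀ y → NonNegFrom y (φ′ p) → NonNegFrom y (map emb p)
NonNegFrom-φ′⁻¹ []                y _ = tt
NonNegFrom-φ′⁻¹ (block a h {r} e) y (first , rest) =
  first , subst (0ℤ ≤_) (sym (+-identityʳ _)) first ,
  NonNegFrom-φ′⁻¹ e _ (subst (λ z → NonNegFrom z (φ′ r)) (sym (+-identityʳ _)) rest)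
NonNegFrom-φ′⁻¹ (block a u e) y (first , second , rest) = first , second , NonNegFrom-φ′⁻¹ e _ rest
NonNegFrom-φ′⁻¹ (block a d e) y (first , second , rest) = first , second , NonNegFrom-φ′⁻¹ e _ rest

Preimage : List WStep → Set
Preimage q = Σ (List MStep) λ p → EvenLength p × φ′ p ≡ q

nonVertical-emb : ∀ s → ¬ IsVertical s → Σ MStep λ a → emb a ≡ s
nonVertical-emb H _ = h , refl
nonVertical-emb U _ = u , refl
nonVertical-emb D _ = d , refl
nonVertical-emb N v = ⊥-elim (v tt)
nonVertical-emb S v = ⊥-elim (v tt)

InAH-after-vertical : ∀ s r → IsVertical s → NoTwoVertical (s ∷ r) → InAH r
InAH-after-vertical s []      _ _               = tt , tt
InAH-after-vertical s (t ∷ r) v (notBoth , ntv) = ntv , notBoth v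

extend : ∀ a b {q} → Preimage q → Preimage (emb a ∷ (vert b ++ q))
extend a b (p , e , refl) = a ∷ b ∷ p , block a b e , refl

mutual
  preimage : ∀ q → InAH q → Preimage q
  preimage []      _             = [] , [] , refl
  preimage (s ∷ q) (ntv , first) with nonVertical-emb s first
  ... | a , refl = preimage-after a q ntv

  preimage-after : ∀ a q → NoTwoVertical (emb a ∷ q) → Preimage (emb a ∷ q)
  preimage-after a []        _         = extend a h ([] , [] , refl)
  preimage-after a (N ∷ r)   (_ , ntv) = extend a u (preimage r (InAH-after-vertical N r tt ntv))
  preimage-after a (S ∷ r)   (_ , ntv) = extend a d (preimage r (InAH-after-vertical S r tt ntv))
  preimage-after a q@(H ∷ _) (_ , ntv) = extend a h (preimage q (ntv , λ ()))
  preimage-after a q@(U ∷ _) (_ , ntv) = extend a h (preimage q (ntv , λ ()))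
  preimage-after a q@(D ∷ _) (_ , ntv) = extend a h (preimage q (ntv , λ ()))

φ′∘ψ′ : ∀ {q} → InAH q → φ′ (ψ′ q) ≡ q
φ′∘ψ′ {q} ah with preimage q ah
... | p , e , refl = cong φ′ (ψ′∘φ′ e)

length-ψ′ : ∀ {q} → InAH q → length (ψ′ q) ≡ 2 * hlen q
length-ψ′ {q} ah with preimage q ah
... | p , e , refl = trans (cong length (ψ′∘φ′ e)) (length≡2*hlen-φ′ e)

IsMotzkin-ψ′ : ∀ {q} → InAQ q → IsMotzkin (ψ′ q)
IsMotzkin-ψ′ {q} (ah , nonNeg) with preimage q ah
... | p , e , refl rewrite ψ′∘φ′ e = NonNegFrom-φ′⁻¹ e 0ℤ nonNeg

theorem8 : (n : ℕ) →
      -- Motzkin paths of length 2n  ⇄  A^Q_R paths of horizontal length n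
      ((p : List MStep) → length p ≡ 2 * n → IsMotzkin p →
          InAQ (φ′ p) × hlen (φ′ p) ≡ n × ψ′ (φ′ p) ≡ p)
    × ((q : List WStep) → InAQ q → hlen q ≡ n →
          (length (ψ′ q) ≡ 2 * n × IsMotzkin (ψ′ q)) × φ′ (ψ′ q) ≡ q)
      -- Grand Motzkin paths of length 2n  ⇄  A^H_R paths of horizontal length n
    × ((p : List MStep) → length p ≡ 2 * n →
          InAH (φ′ p) × hlen (φ′ p) ≡ n × ψ′ (φ′ p) ≡ p)
    × ((q : List WStep) → InAH q → hlen q ≡ n →
          length (ψ′ q) ≡ 2 * n × φ′ (ψ′ q) ≡ q)
theorem8 n =
    (λ p |p| motzkin → (InAH-φ′ p , NonNegFrom-φ′ (evenLength n p |p|) 0ℤ motzkin)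
                       , hlen-φ′ n p |p| , ψ′∘φ′ (evenLength n p |p|))
  , (λ q (ah , nonNeg) hl → (length-ψ′-≡ ah hl , IsMotzkin-ψ′ (ah , nonNeg)) , φ′∘ψ′ ah)
  , (λ p |p| → InAH-φ′ p , hlen-φ′ n p |p| , ψ′∘φ′ (evenLength n p |p|))
  , (λ q ah hl → length-ψ′-≡ ah hl , φ′∘ψ′ ah)
  where
  length-ψ′-≡ : ∀ {q} → InAH q → hlen q ≡ n → length (ψ′ q) ≡ 2 * n
  length-ψ′-≡ ah hl = trans (length-ψ′ ah) (cong (2 *_) hl)
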